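{- Let $\mathcal{A}$ be a commutative algebra over a field, let $R_n,q_n\in\mathcal A$ for $n\geq 0$ with $q_0=1$, and set $q_n=0$ for $n<0$. For a partition $\nu=(\nu_1,\dots,\nu_r)$ with all parts positive ($r\geq 1$) define $$T.q_\nu=\sum_{i_1,\dots,i_r\geq 1}R_{i_1+\cdots+i_r}\,q_{\nu_1-i_1}\cdots q_{\nu_r-i_r}\in\mathcal{A}.$$ For nonnegative integers $a_1,\dots,a_r$ let $[a_1,\dots,a_r]$ denote the partition obtained by arranging them in decreasing order. Let $s\geq 1$ and let $(\lambda_1,\dots,\lambda_s,a+1)$ be a partition with $a\geq 1$ (all parts positive). Then $$T.q_{(\lambda_1,\dots,\lambda_s,1)}=T.q_{[\lambda_1,\dots,\lambda_{s-1},\lambda_s+1]}-q_{\lambda_s}\,T.q_{(\lambda_1,\dots,\lambda_{s-1},1)},$$ $$T.q_{(\lambda_1,\dots,\lambda_s,a+1)}=T.q_{[\lambda_1,\dots,\lambda_{s-1},\lambda_s+1,a]}+q_a\,T.q_{[\lambda_1,\dots,\lambda_{s-1},\lambda_s+1]}-q_{\lambda_s}\,T.q_{(\lambda_1,\dots,\lambda_{s-1},a+1)}.$$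
   Context: When $s=1$, the sequences $(\lambda_1,\dots,\lambda_{s-1},x)$ are to be read as $(x)$. -}

module Defs where

open import Level using (Level)
open import Data.Nat using (ℕ; zero; suc; _≥_; _<_) renaming (_+_ to _+ℕ_)
open import Data.Nat.Properties using (≤-decTotalOrder)
open import Data.List using (List; []; _∷_)
open import Data.List.Relation.Unary.All using (All)
open import Data.List.Relation.Unary.Linked using (Linked)
open import Data.Product using (_×_)
open import Algebra.Bundles using (CommutativeRing)
import Relation.Binary.Construct.Flip.EqAndOrd as Flip
import Data.List.Sort as Sort

IsPartition : List ℕ → Set
IsPartition ν = Linked _≥_ ν × All (λ x → 0 < x) ν

sortDesc : List ℕ → List ℕ
sortDesc = Sort.sort (Flip.decTotalOrder ≤-decTotalOrder)

module _ {c ℓ : Level} (A : CommutativeRing c ℓ) where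
  open CommutativeRing A

  sumFrom1 : ℕ → (ℕ → Carrier) → Carrier
  sumFrom1 zero    f = 0#
  sumFrom1 (suc m) f = sumFrom1 m f + f (suc m)

  -- qq q n m = q_{n - m}, with the convention q_k = 0 for k < 0.
  qq : (ℕ → Carrier) → ℕ → ℕ → Carrier
  qq q n       zero    = q n
  qq q zero    (suc m) = 0#
  qq q (suc n) (suc m) = qq q n m

  -- TqAux R q k (ν₁,…,νᵣ) = Σ_{i₁,…,iᵣ ≥ 1} R_{k+i₁+⋯+iᵣ} q_{ν₁-i₁} ⋯ q_{νᵣ-iᵣ},
  -- where the sum over each i_j is restricted to 1 ≤ i_j ≤ ν_j (the other
  -- terms vanish since q_n = 0 for n < 0).
  TqAux : (ℕ → Carrier) → (ℕ → Carrier) → ℕ → List ℕ → Carrier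
  TqAux R q k []      = R k
  TqAux R q k (n ∷ ν) = sumFrom1 n (λ i → qq q n i * TqAux R q (k +ℕ i) ν)

  Tq : (ℕ → Carrier) → (ℕ → Carrier) → List ℕ → Carrier
  Tq R q ν = TqAux R q 0 ν

module Submission where

-- Write T_k(ν) = TqAux R q k ν, so that T.q_ν = T_0(ν), and
-- the sum over the first part of ν = (n, μ) gives the recursion
--   T_k(n, μ) = Σ_{i=1}^{n} q_{n-i} T_{k+i}(μ).
-- (1) Peeling off the term i = 1 yields the shift rule
--       T_k(n+1, μ) = q_n T_{k+1}(μ) + T_{k+1}(n, μ).
-- (2) T_k(ν) is symmetric in the parts of ν (exchange the two finite sums),
--     so the sorting in [ … ] is harmless, and the shift rule applies to
--     any part, not only the first.
-- (3) Applying the shift rule to each side gives the exchange identity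
--       T_k(l, a+1, μ) + q_l T_k(a+1, μ) = T_k(l+1, a, μ) + q_a T_k(l+1, μ),
--     valid for all l, a, μ; a part equal to 0 makes T vanish.
-- (4) T_k(λs ++ ν) is a linear combination of the T_{k'}(ν), so any linear
--     relation holding for all k survives prepending the parts λs.
-- The theorem is (3) with μ = [] prepended by λs via (4): for a ≥ 1 it is
-- the second formula, for a = 0 (using q_0 = 1) it is the first.

open import Defs
open import Level using (Level)
open import Data.Nat using (ℕ; zero; suc; _≥_)
open import Data.List using (List; []; _∷_; _++_)
open import Data.Product using (_×_; _,_)
open import Algebra.Bundles using (CommutativeRing)

import Data.Nat as ℕ
import Data.Nat.Properties as ℕₚ
open import Data.List.Properties using (++-assoc)
open import Data.Nat.Properties using (≤-decTotalOrder)
import Relation.Binary.Construct.Flip.EqAndOrd as Flip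
open import Data.List.Sort (Flip.decTotalOrder ≤-decTotalOrder) using (sort-↭)
import Data.List.Relation.Binary.Permutation.Propositional as Perm
open Perm using (_↭_)
import Relation.Binary.PropositionalEquality as P
open import Data.Maybe using (nothing)
import Tactic.RingSolver.Core.AlmostCommutativeRing as ACR
import Relation.Binary.Reasoning.Setoid as SetoidReasoning

module Sums {c ℓ : Level} (A : CommutativeRing c ℓ) where
  open CommutativeRing A
  open SetoidReasoning setoid

  Σ₁ : ℕ → (ℕ → Carrier) → Carrier
  Σ₁ = sumFrom1 A

  Σ₁-cong : ∀ n {f g : ℕ → Carrier} → (∀ i → f i ≈ g i) → Σ₁ n f ≈ Σ₁ n g
  Σ₁-cong zero    f≈g = refl
  Σ₁-cong (suc n) f≈g = +-cong (Σ₁-cong n f≈g) (f≈g (suc n))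

  Σ₁-peel : ∀ n (f : ℕ → Carrier) → Σ₁ (suc n) f ≈ f 1 + Σ₁ n (λ i → f (suc i))
  Σ₁-peel zero    f = trans (+-identityˡ _) (sym (+-identityʳ _))
  Σ₁-peel (suc n) f = trans (+-cong (Σ₁-peel n f) refl) (+-assoc _ _ _)

  Σ₁-zero : ∀ n → Σ₁ n (λ _ → 0#) ≈ 0#
  Σ₁-zero zero    = refl
  Σ₁-zero (suc n) = trans (+-identityʳ _) (Σ₁-zero n)

  Σ₁-+ : ∀ n (f g : ℕ → Carrier) → Σ₁ n (λ i → f i + g i) ≈ Σ₁ n f + Σ₁ n g
  Σ₁-+ zero    f g = sym (+-identityʳ _)
  Σ₁-+ (suc n) f g = begin
    Σ₁ n (λ i → f i + g i) + (f (suc n) + g (suc n))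
      ≈⟨ +-cong (Σ₁-+ n f g) refl ⟩
    (Σ₁ n f + Σ₁ n g) + (f (suc n) + g (suc n))
      ≈⟨ +-assoc _ _ _ ⟩
    Σ₁ n f + (Σ₁ n g + (f (suc n) + g (suc n)))
      ≈⟨ +-cong refl (trans (sym (+-assoc _ _ _))
           (trans (+-cong (+-comm _ _) refl) (+-assoc _ _ _))) ⟩
    Σ₁ n f + (f (suc n) + (Σ₁ n g + g (suc n)))
      ≈⟨ sym (+-assoc _ _ _) ⟩
    Σ₁ (suc n) f + Σ₁ (suc n) g ∎

  Σ₁-*ˡ : ∀ n (x : Carrier) (f : ℕ → Carrier) → Σ₁ n (λ i → x * f i) ≈ x * Σ₁ n f
  Σ₁-*ˡ zero    x f = sym (zeroʳ x)
  Σ₁-*ˡ (suc n) x f = trans (+-cong (Σ₁-*ˡ n x f) refl) (sym (distribˡ _ _ _))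

  Σ₁-swap : ∀ n m (F : ℕ → ℕ → Carrier) →
    Σ₁ n (λ i → Σ₁ m (F i)) ≈ Σ₁ m (λ j → Σ₁ n (λ i → F i j))
  Σ₁-swap zero    m F = sym (Σ₁-zero m)
  Σ₁-swap (suc n) m F = trans (+-cong (Σ₁-swap n m F) refl)
    (sym (Σ₁-+ m (λ j → Σ₁ n (λ i → F i j)) (F (suc n))))

  Σ₁-linear : ∀ n (w f g h e : ℕ → Carrier) (c d : Carrier) →
    (∀ i → f i + d * e i ≈ g i + c * h i) →
    Σ₁ n (λ i → w i * f i) + d * Σ₁ n (λ i → w i * e i)
      ≈ Σ₁ n (λ i → w i * g i) + c * Σ₁ n (λ i → w i * h i)
  Σ₁-linear n w f g h e c d rel = begin
    Σ₁ n (λ i → w i * f i) + d * Σ₁ n (λ i → w i * e i)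
      ≈⟨ sym (combine f e d) ⟩
    Σ₁ n (λ i → w i * f i + d * (w i * e i))
      ≈⟨ Σ₁-cong n (λ i → trans (termwise f e d i)
           (trans (*-cong refl (rel i)) (sym (termwise g h c i)))) ⟩
    Σ₁ n (λ i → w i * g i + c * (w i * h i))
      ≈⟨ combine g h c ⟩
    Σ₁ n (λ i → w i * g i) + c * Σ₁ n (λ i → w i * h i) ∎
    where
      combine : ∀ u v x → Σ₁ n (λ i → w i * u i + x * (w i * v i))
                          ≈ Σ₁ n (λ i → w i * u i) + x * Σ₁ n (λ i → w i * v i)
      combine u v x = trans (Σ₁-+ n _ _) (+-cong refl (Σ₁-*ˡ n x _))
      termwise : ∀ u v x i → w i * u i + x * (w i * v i) ≈ w i * (u i + x * v i)
      termwise u v x i = trans (+-cong refl (trans (sym (*-assoc _ _ _))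
        (trans (*-cong (*-comm _ _) refl) (*-assoc _ _ _)))) (sym (distribˡ _ _ _))

module Theory {c ℓ : Level} (A : CommutativeRing c ℓ) (R q : ℕ → CommutativeRing.Carrier A) where
  open CommutativeRing A
  open Sums A
  open SetoidReasoning setoid
  open import Tactic.RingSolver.NonReflective (ACR.fromCommutativeRing A (λ _ → nothing))
    using (solve; _⊜_; _⊕_; _⊗_)

  T : ℕ → List ℕ → Carrier
  T = TqAux A R q

  q[_-_] : ℕ → ℕ → Carrier
  q[_-_] = qq A q

  T-index : ∀ {k k′} ν → k P.≡ k′ → T k ν ≈ T k′ ν
  T-index ν k≡k′ = reflexive (P.cong (λ k → T k ν) k≡k′)

  T-shift : ∀ k n μ → T k (suc n ∷ μ) ≈ q n * T (suc k) μ + T (suc k) (n ∷ μ)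
  T-shift k n μ = trans (Σ₁-peel n (λ i → q[ (suc n) - i ] * T (k ℕ.+ i) μ))
    (+-cong (*-cong refl (T-index μ (ℕₚ.+-comm k 1)))
            (Σ₁-cong n (λ i → *-cong refl (T-index μ (ℕₚ.+-suc k i)))))

  T-perm : ∀ {ν ν′} → ν ↭ ν′ → ∀ k → T k ν ≈ T k ν′
  T-perm Perm.refl           k = refl
  T-perm (Perm.prep n p)     k = Σ₁-cong n (λ i → *-cong refl (T-perm p (k ℕ.+ i)))
  T-perm (Perm.trans p p′)   k = trans (T-perm p k) (T-perm p′ k)
  T-perm {m ∷ n ∷ μ} {.n ∷ .m ∷ μ′} (Perm.swap m n p) k = begin
    Σ₁ m (λ i → q[ m - i ] * Σ₁ n (λ j → q[ n - j ] * T (k ℕ.+ i ℕ.+ j) μ))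
      ≈⟨ Σ₁-cong m (λ i → sym (Σ₁-*ˡ n _ _)) ⟩
    Σ₁ m (λ i → Σ₁ n (λ j → q[ m - i ] * (q[ n - j ] * T (k ℕ.+ i ℕ.+ j) μ)))
      ≈⟨ Σ₁-swap m n _ ⟩
    Σ₁ n (λ j → Σ₁ m (λ i → q[ m - i ] * (q[ n - j ] * T (k ℕ.+ i ℕ.+ j) μ)))
      ≈⟨ Σ₁-cong n (λ j → Σ₁-cong m (λ i → trans
           (solve 3 (λ x y t → x ⊗ (y ⊗ t) ⊜ y ⊗ (x ⊗ t)) refl _ _ _)
           (*-cong refl (*-cong refl
             (trans (T-index μ (reorder i j)) (T-perm p (k ℕ.+ j ℕ.+ i))))))) ⟩
    Σ₁ n (λ j → Σ₁ m (λ i → q[ n - j ] * (q[ m - i ] * T (k ℕ.+ j ℕ.+ i) μ′)))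
      ≈⟨ Σ₁-cong n (λ j → Σ₁-*ˡ m _ _) ⟩
    Σ₁ n (λ j → q[ n - j ] * Σ₁ m (λ i → q[ m - i ] * T (k ℕ.+ j ℕ.+ i) μ′)) ∎
    where
      reorder : ∀ i j → k ℕ.+ i ℕ.+ j P.≡ k ℕ.+ j ℕ.+ i
      reorder i j = P.trans (ℕₚ.+-assoc k i j) (P.trans (P.cong (k ℕ.+_) (ℕₚ.+-comm i j))
                      (P.sym (ℕₚ.+-assoc k j i)))

  -- A part equal to 0 contributes an empty sum, so T vanishes.
  T-zero-part : ∀ ν μ k → T k (ν ++ 0 ∷ μ) ≈ 0#
  T-zero-part []      μ k = refl
  T-zero-part (n ∷ ν) μ k = trans (Σ₁-cong n (λ i → trans (*-cong refl (T-zero-part ν μ (k ℕ.+ i)))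
                                                           (zeroʳ _)))
                                  (Σ₁-zero n)

  T-exchange : ∀ k l a μ →
    T k (l ∷ suc a ∷ μ) + q l * T k (suc a ∷ μ)
      ≈ T k (suc l ∷ a ∷ μ) + q a * T k (suc l ∷ μ)
  T-exchange k l a μ = begin
    T k (l ∷ suc a ∷ μ) + q l * T k (suc a ∷ μ)
      ≈⟨ +-cong (T-perm (Perm.swap l (suc a) (Perm.refl {xs = μ})) k) refl ⟩
    T k (suc a ∷ l ∷ μ) + q l * T k (suc a ∷ μ)
      ≈⟨ +-cong (T-shift k a (l ∷ μ)) (*-cong refl (T-shift k a μ)) ⟩
    (q a * Tₗ + Tₐₗ) + q l * (q a * Tμ + Tₐ)
      ≈⟨ solve 6 (λ qa ql x y z u → (qa ⊗ x ⊕ y) ⊕ ql ⊗ (qa ⊗ z ⊕ u)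
                                  ⊜ ((ql ⊗ u ⊕ y) ⊕ qa ⊗ (ql ⊗ z ⊕ x)))
           refl (q a) (q l) Tₗ Tₐₗ Tμ Tₐ ⟩
    (q l * Tₐ + Tₐₗ) + q a * (q l * Tμ + Tₗ)
      ≈⟨ +-cong (+-cong refl (T-perm (Perm.swap a l (Perm.refl {xs = μ})) (suc k))) refl ⟩
    (q l * Tₐ + T (suc k) (l ∷ a ∷ μ)) + q a * (q l * Tμ + Tₗ)
      ≈⟨ sym (+-cong (T-shift k l (a ∷ μ)) (*-cong refl (T-shift k l μ))) ⟩
    T k (suc l ∷ a ∷ μ) + q a * T k (suc l ∷ μ) ∎
    where
      Tμ Tₗ Tₐ Tₐₗ : Carrier
      Tμ  = T (suc k) μ
      Tₗ  = T (suc k) (l ∷ μ)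
      Tₐ  = T (suc k) (a ∷ μ)
      Tₐₗ = T (suc k) (a ∷ l ∷ μ)

  T-prepend : ∀ λs {ν₁ ν₂ ν₃ ν₄} (c d : Carrier) →
    (∀ k → T k ν₁ + d * T k ν₄ ≈ T k ν₂ + c * T k ν₃) →
    ∀ k → T k (λs ++ ν₁) + d * T k (λs ++ ν₄) ≈ T k (λs ++ ν₂) + c * T k (λs ++ ν₃)
  T-prepend []       c d rel k = rel k
  T-prepend (n ∷ λs) {ν₁} {ν₂} {ν₃} {ν₄} c d rel k =
    Σ₁-linear n (λ i → q[ n - i ]) (at ν₁) (at ν₂) (at ν₃) (at ν₄) c d
      (λ i → T-prepend λs c d rel (k ℕ.+ i))
    where
      at : List ℕ → ℕ → Carrier
      at ν i = T (k ℕ.+ i) (λs ++ ν)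

  T-sort : ∀ ν → T 0 (sortDesc ν) ≈ T 0 ν
  T-sort ν = T-perm (sort-↭ ν) 0

  x+z≈v⇒x≈v-z : ∀ {x z v} → x + z ≈ v → x ≈ v - z
  x+z≈v⇒x≈v-z {x} {z} {v} x+z≈v = begin
    x             ≈⟨ sym (+-identityʳ x) ⟩
    x + 0#        ≈⟨ +-cong refl (sym (-‿inverseʳ z)) ⟩
    x + (z - z)   ≈⟨ sym (+-assoc x z (- z)) ⟩
    (x + z) - z   ≈⟨ +-cong x+z≈v refl ⟩
    v - z         ∎

mainTheorem3 : {c ℓ : Level} (A : CommutativeRing c ℓ) →
    let open CommutativeRing A in
    (R q : ℕ → Carrier) → q 0 ≈ 1# →
    (λs : List ℕ) (l a : ℕ) → a ≥ 1 →
    IsPartition (λs ++ l ∷ suc a ∷ []) →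
    (Tq A R q (λs ++ l ∷ 1 ∷ [])
    ≈ Tq A R q (sortDesc (λs ++ suc l ∷ []))
    - q l * Tq A R q (λs ++ 1 ∷ []))
    ×
    (Tq A R q (λs ++ l ∷ suc a ∷ [])
    ≈ (Tq A R q (sortDesc (λs ++ suc l ∷ a ∷ []))
    + q a * Tq A R q (sortDesc (λs ++ suc l ∷ [])))
    - q l * Tq A R q (λs ++ suc a ∷ []))
mainTheorem3 A R q q₀≈1 λs l a _ _ = firstFormula , secondFormula
  where
    open CommutativeRing A
    open Theory A R q

    exchange : ∀ b → T 0 (λs ++ l ∷ suc b ∷ []) + q l * T 0 (λs ++ suc b ∷ [])
                       ≈ T 0 (λs ++ suc l ∷ b ∷ []) + q b * T 0 (λs ++ suc l ∷ [])
    exchange b = T-prepend λs (q b) (q l) (λ k → T-exchange k l b []) 0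

    -- For b = 0 the first term on the right vanishes and q_0 = 1.
    firstFormula : T 0 (λs ++ l ∷ 1 ∷ [])
                     ≈ T 0 (sortDesc (λs ++ suc l ∷ [])) - q l * T 0 (λs ++ 1 ∷ [])
    firstFormula = x+z≈v⇒x≈v-z (trans (exchange 0) (begin
      T 0 (λs ++ suc l ∷ 0 ∷ []) + q 0 * T 0 (λs ++ suc l ∷ [])
        ≈⟨ +-cong vanishes (*-cong q₀≈1 (sym (T-sort (λs ++ suc l ∷ [])))) ⟩
      0# + 1# * T 0 (sortDesc (λs ++ suc l ∷ []))
        ≈⟨ trans (+-identityˡ _) (*-identityˡ _) ⟩
      T 0 (sortDesc (λs ++ suc l ∷ [])) ∎))
      where
        open SetoidReasoning setoid
        vanishes : T 0 (λs ++ suc l ∷ 0 ∷ []) ≈ 0#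
        vanishes = P.subst (λ ν → T 0 ν ≈ 0#) (++-assoc λs (suc l ∷ []) (0 ∷ []))
                     (T-zero-part (λs ++ suc l ∷ []) [] 0)

    secondFormula : T 0 (λs ++ l ∷ suc a ∷ [])
                      ≈ (T 0 (sortDesc (λs ++ suc l ∷ a ∷ []))
                         + q a * T 0 (sortDesc (λs ++ suc l ∷ [])))
                        - q l * T 0 (λs ++ suc a ∷ [])
    secondFormula = x+z≈v⇒x≈v-z (trans (exchange a)
      (+-cong (sym (T-sort _)) (*-cong refl (sym (T-sort _)))))
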